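{- Fix $\varepsilon\in(0,1)$. There exists a constant $c_t>0$ depending only on $\varepsilon$ such that the following holds for all sufficiently large positive integers $k>r$. Let $N=\frac{k}{2r}$ and let $S\subset\mathbb{Z}^3$ be a set of indivisible vectors, each of whose coordinates is an integer between $\lceil\varepsilon N\rceil$ and $N$, such that any three distinct elements of $S$ are linearly independent over $\mathbb{R}$. Let $\mathcal{L}$ be the set of lines $\ell\subset\mathbb{R}^3$ that are parallel to some $\mathbf{v}\in S$ and satisfy $|\ell\cap[k]^3|\ge r$, and let $G$ be the intersection graph of $\mathcal{L}$. Then the number of triangles in $G$ is at most $c_t\cdot\frac{|S|^3k^9}{r^6}$.
   Context: $[k]=\{1,\dots,k\}$. A vector in $\mathbb{Z}^3$ is indivisible if the greatest common divisor of its coordinates is $1$. The intersection graph of $\mathcal{L}$ has vertex set $\mathcal{L}$, two distinct lines being adjacent iff they intersect.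
   Formalization: The parameter ε ranges over the rationals in $(0,1)$ rather than over all reals, and the lines of $\mathcal{L}$ are represented by their rational points in ℚ³. -}

module Defs where

open import Data.Nat as ℕ using (ℕ; zero; suc)
open import Data.Integer as ℤ using (ℤ; +_)
open import Data.Integer.GCD as ℤG using ()
open import Data.Rational as ℚ using (ℚ; 0ℚ; _/_)
open import Data.Product using (Σ; ∃; _×_; _,_; proj₁; proj₂)
open import Data.List using (List; length)
open import Data.List.Membership.Propositional using (_∈_)
open import Data.List.Relation.Unary.All using (All)
open import Data.List.Relation.Unary.AllPairs using (AllPairs)
open import Data.List.Relation.Unary.Unique.Propositional using (Unique)
open import Function.Bundles using (_⇔_)
open import Relation.Binary.PropositionalEquality using (_≡_; _≢_)
open import Relation.Nullary using (¬_)

Z3 : Set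
Z3 = ℤ × ℤ × ℤ

Q3 : Set
Q3 = ℚ × ℚ × ℚ

toQ3 : Z3 → Q3
toQ3 (a , b , c) = (a / 1 , b / 1 , c / 1)

natToQ3 : ℕ × ℕ × ℕ → Q3
natToQ3 (a , b , c) = (+ a / 1 , + b / 1 , + c / 1)

_+³_ : Q3 → Q3 → Q3
(a , b , c) +³ (x , y , z) = (a ℚ.+ x , b ℚ.+ y , c ℚ.+ z)

_•_ : ℚ → Q3 → Q3
t • (x , y , z) = (t ℚ.* x , t ℚ.* y , t ℚ.* z)

0³ : Q3
0³ = (0ℚ , 0ℚ , 0ℚ)

Indivisible : Z3 → Set
Indivisible (a , b , c) = ℤG.gcd (ℤG.gcd a b) c ≡ + 1

-- linear independence of three vectors (coefficients over ℚ; for rational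
-- vectors this coincides with linear independence over ℝ)
LinIndep : Z3 → Z3 → Z3 → Set
LinIndep u v w = ∀ (a b c : ℚ) →
  ((a • toQ3 u) +³ ((b • toQ3 v) +³ (c • toQ3 w))) ≡ 0³ →
  (a ≡ 0ℚ) × (b ≡ 0ℚ) × (c ≡ 0ℚ)

-- a line { base + t • dir : t } (traced on ℚ³)
record Line : Set where
  constructor line
  field
    base : Q3
    dir  : Q3
open Line public

_OnLine_ : Q3 → Line → Set
x OnLine ℓ = ∃ λ (t : ℚ) → x ≡ (base ℓ +³ (t • dir ℓ))

SameLine : Line → Line → Set
SameLine ℓ ℓ' = ∀ x → (x OnLine ℓ) ⇔ (x OnLine ℓ')

Intersect : Line → Line → Set
Intersect ℓ ℓ' = ∃ λ x → (x OnLine ℓ) × (x OnLine ℓ')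

ParallelTo : Line → Z3 → Set
ParallelTo ℓ v = ∃ λ (λ' : ℚ) → (λ' ≢ 0ℚ) × (dir ℓ ≡ λ' • toQ3 v)

InCube : ℕ → ℕ × ℕ × ℕ → Set
InCube k (a , b , c) =
  (1 ℕ.≤ a × a ℕ.≤ k) × (1 ℕ.≤ b × b ℕ.≤ k) × (1 ℕ.≤ c × c ℕ.≤ k)

CubePointsAtLeast : ℕ → ℕ → Line → Set
CubePointsAtLeast k r ℓ = ∃ λ (ps : List (ℕ × ℕ × ℕ)) →
  Unique ps × All (InCube k) ps × All (λ p → natToQ3 p OnLine ℓ) ps ×
  r ℕ.≤ length ps

InL : List Z3 → ℕ → ℕ → Line → Set
InL S k r ℓ = (∃ λ v → v ∈ S × ParallelTo ℓ v) × CubePointsAtLeast k r ℓ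

-- triangles of the intersection graph, as (ordered representatives of)
-- unordered triples
Triple : Set
Triple = Line × Line × Line

IsTriangle : List Z3 → ℕ → ℕ → Triple → Set
IsTriangle S k r (ℓ₁ , ℓ₂ , ℓ₃) =
  InL S k r ℓ₁ × InL S k r ℓ₂ × InL S k r ℓ₃ ×
  ¬ SameLine ℓ₁ ℓ₂ × ¬ SameLine ℓ₂ ℓ₃ × ¬ SameLine ℓ₁ ℓ₃ ×
  Intersect ℓ₁ ℓ₂ × Intersect ℓ₂ ℓ₃ × Intersect ℓ₁ ℓ₃

OccursIn : Line → Triple → Set
OccursIn ℓ (ℓ₁ , ℓ₂ , ℓ₃) = SameLine ℓ ℓ₁ Data.Sum.⊎ (SameLine ℓ ℓ₂ Data.Sum.⊎ SameLine ℓ ℓ₃)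
  where import Data.Sum

SameTriangle : Triple → Triple → Set
SameTriangle t@(ℓ₁ , ℓ₂ , ℓ₃) t'@(m₁ , m₂ , m₃) =
  (OccursIn ℓ₁ t' × OccursIn ℓ₂ t' × OccursIn ℓ₃ t') ×
  (OccursIn m₁ t × OccursIn m₂ t × OccursIn m₃ t)

-- "the number of triangles is at most B": every list of pairwise distinct
-- triangles has length at most B (B given as the condition on the length)
TriangleCountBound : List Z3 → ℕ → ℕ → (ℕ → Set) → Set
TriangleCountBound S k r Bound = ∀ (T : List Triple) →
  All (IsTriangle S k r) T → AllPairs (λ t t' → ¬ SameTriangle t t') T →
  Bound (length T)

-- N = k / (2r)  (value at r = 0 is irrelevant; r ≥ 1 is assumed)
Nval : ℕ → ℕ → ℚ
Nval k zero = 0ℚ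
Nval k (suc r) = (+ k) / (2 ℕ.* suc r)

CoordOK : ℚ → ℕ → ℕ → ℤ → Set
CoordOK ε k r x = (ℚ.⌈ ε ℚ.* Nval k r ⌉ ℤ.≤ x) × ((x / 1) ℚ.≤ Nval k r)

VecOK : ℚ → ℕ → ℕ → Z3 → Set
VecOK ε k r (a , b , c) = CoordOK ε k r a × CoordOK ε k r b × CoordOK ε k r c

{-# OPTIONS --safe #-}
module Submission where

-- Two lines with the same direction that meet coincide, so the lines of a triangle have three
-- distinct, hence linearly independent, directions v₁, v₂, v₃ ∈ S, and three pairwise intersecting
-- lines with independent directions pass through one point P. By Cramer's rule P is determined by
-- the three numbers P · (vᵢ ⨯ vᵢ₊₁), and P · (vᵢ ⨯ vᵢ₊₁) = c · (vᵢ ⨯ vᵢ₊₁) for any c ∈ ℓᵢ ∩ [k]³,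
-- an integer of absolute value at most 6kn² where n = ⌊k/2r⌋ bounds the coordinates of S. So a
-- triangle is determined by (v₁, v₂, v₃) and three such integers, and there are at most
-- |S|³(2(6kn² + 1))³ ≤ 125|S|³k⁹/r⁶ triangles.

open import Defs
open import Data.Nat as ℕ using (ℕ; zero; suc; _≤_; s≤s; z≤n; _≤?_)
import Data.Nat.Properties as ℕP
import Data.Nat.DivMod as ℕD
import Data.Nat.Tactic.RingSolver as ℕ-Solver
open import Data.Integer as ℤ using (ℤ; +_; -[1+_]; +[1+_]; ∣_∣; 0ℤ)
import Data.Integer.Properties as ℤP
import Data.Integer.DivMod as ℤD
import Data.Integer.Tactic.RingSolver as ℤ-Solver
open import Data.Rational as ℚ using (ℚ; 0ℚ; 1ℚ; mkℚ; _/_; _+_; _*_; _-_; -_; 1/_; toℚᵘ)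
import Data.Rational.Properties as ℚP
open import Data.Rational.Unnormalised as ℚᵘ using (mkℚᵘ; *≡*; *≤*)
import Data.Rational.Unnormalised.Properties as ℚᵘP
open import Data.Fin as Fin using (Fin; zero; suc; fromℕ<; combine)
import Data.Fin.Properties as FinP
open import Data.List using (List; _∷_; length; lookup)
open import Data.List.Membership.Propositional using (_∈_)
open import Data.List.Membership.Propositional.Properties using (∈-lookup)
import Data.List.Membership.Setoid.Properties as Membership
open import Data.List.Relation.Unary.All as All using (All; _∷_)
open import Data.List.Relation.Unary.AllPairs using (AllPairs; _∷_)
open import Data.List.Relation.Unary.Any using (index)
open import Data.List.Relation.Unary.Unique.Propositional using (Unique)
open import Data.Product using (Σ; ∃; _×_; _,_; proj₁; proj₂)
open import Data.Sum using (inj₁; inj₂)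
open import Function using (_∘_)
open import Function.Bundles using (mk⇔)
open import Level using (0ℓ)
open import Relation.Binary.PropositionalEquality
open import Relation.Nullary using (¬_; yes; no; contradiction)
open import Relation.Nullary.Decidable using (dec⇒maybe)
open import Tactic.RingSolver using (solve-∀)
import Tactic.RingSolver.Core.AlmostCommutativeRing as ACR

ℚ-ring : ACR.AlmostCommutativeRing 0ℓ 0ℓ
ℚ-ring = ACR.fromCommutativeRing ℚP.+-*-commutativeRing (λ q → dec⇒maybe (0ℚ ℚP.≟ q))

ι : ℤ → ℚ
ι i = i / 1

toℚᵘ-ι : ∀ i → toℚᵘ (ι i) ℚᵘ.≃ mkℚᵘ i 0
toℚᵘ-ι i = ℚP.toℚᵘ-fromℚᵘ (mkℚᵘ i 0)

≃ᵘ⇒ι≡ : ∀ {i p} → mkℚᵘ i 0 ℚᵘ.≃ toℚᵘ p → ι i ≡ p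
≃ᵘ⇒ι≡ {i} eq = ℚP.toℚᵘ-injective (ℚᵘP.≃-trans (toℚᵘ-ι i) eq)

ι-homo-+ : ∀ i j → ι (i ℤ.+ j) ≡ ι i + ι j
ι-homo-+ i j = ≃ᵘ⇒ι≡ (begin
  mkℚᵘ (i ℤ.+ j) 0             ≈⟨ *≡* (nf i j) ⟩
  mkℚᵘ i 0 ℚᵘ.+ mkℚᵘ j 0       ≈⟨ ℚᵘP.+-cong (toℚᵘ-ι i) (toℚᵘ-ι j) ⟨
  toℚᵘ (ι i) ℚᵘ.+ toℚᵘ (ι j)   ≈⟨ ℚP.toℚᵘ-homo-+ (ι i) (ι j) ⟨
  toℚᵘ (ι i + ι j)             ∎)
  where
  open ℚᵘP.≃-Reasoning
  nf : ∀ i j → (i ℤ.+ j) ℤ.* + 1 ≡ (i ℤ.* + 1 ℤ.+ j ℤ.* + 1) ℤ.* + 1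
  nf = ℤ-Solver.solve-∀

ι-homo-* : ∀ i j → ι (i ℤ.* j) ≡ ι i * ι j
ι-homo-* i j = ≃ᵘ⇒ι≡ (begin
  mkℚᵘ (i ℤ.* j) 0             ≈⟨ ℚᵘP.*-cong (toℚᵘ-ι i) (toℚᵘ-ι j) ⟨
  toℚᵘ (ι i) ℚᵘ.* toℚᵘ (ι j)   ≈⟨ ℚP.toℚᵘ-homo-* (ι i) (ι j) ⟨
  toℚᵘ (ι i * ι j)             ∎)
  where open ℚᵘP.≃-Reasoning

ι-homo-neg : ∀ i → ι (ℤ.- i) ≡ - ι i
ι-homo-neg i = ≃ᵘ⇒ι≡ (begin
  mkℚᵘ (ℤ.- i) 0               ≈⟨ ℚᵘP.-‿cong (toℚᵘ-ι i) ⟨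
  ℚᵘ.- toℚᵘ (ι i)              ≈⟨ ℚP.toℚᵘ-homo‿- (ι i) ⟨
  toℚᵘ (- ι i)                 ∎)
  where open ℚᵘP.≃-Reasoning

ι-homo-sub : ∀ i j → ι (i ℤ.- j) ≡ ι i - ι j
ι-homo-sub i j = trans (ι-homo-+ i (ℤ.- j)) (cong (_+_ (ι i)) (ι-homo-neg j))

ι-mono-≤ : ∀ {i j} → i ℤ.≤ j → ι i ℚ.≤ ι j
ι-mono-≤ {i} {j} i≤j = ℚP.toℚᵘ-cancel-≤ (begin
  toℚᵘ (ι i)   ≃⟨ toℚᵘ-ι i ⟩
  mkℚᵘ i 0     ≤⟨ ℚᵘ.*≤* (ℤP.*-monoʳ-≤-nonNeg (+ 1) i≤j) ⟩
  mkℚᵘ j 0     ≃⟨ toℚᵘ-ι j ⟨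
  toℚᵘ (ι j)   ∎)
  where open ℚᵘP.≤-Reasoning

infix 7 _·_
infix 8 _⨯_

_·_ : Q3 → Q3 → ℚ
(x₁ , x₂ , x₃) · (y₁ , y₂ , y₃) = x₁ * y₁ + x₂ * y₂ + x₃ * y₃

_⨯_ : Q3 → Q3 → Q3
(x₁ , x₂ , x₃) ⨯ (y₁ , y₂ , y₃) = (x₂ * y₃ - x₃ * y₂ , x₃ * y₁ - x₁ * y₃ , x₁ * y₂ - x₂ * y₁)

det : Q3 → Q3 → Q3 → ℚ
det a b c = a · b ⨯ c

rotate : Q3 → Q3
rotate (x₁ , x₂ , x₃) = (x₂ , x₃ , x₁)

-- Defs' LinIndep u v w is LinIndepℚ (toQ3 u) (toQ3 v) (toQ3 w) by definition.
LinIndepℚ : Q3 → Q3 → Q3 → Set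
LinIndepℚ a b c = ∀ (α β γ : ℚ) →
  ((α • a) +³ ((β • b) +³ (γ • c))) ≡ 0³ → (α ≡ 0ℚ) × (β ≡ 0ℚ) × (γ ≡ 0ℚ)

cong₃ : ∀ {A B C D : Set} (f : A → B → C → D) {x x′ y y′ z z′} →
        x ≡ x′ → y ≡ y′ → z ≡ z′ → f x y z ≡ f x′ y′ z′
cong₃ f refl refl refl = refl

≡³ : ∀ {x₁ x₂ x₃ y₁ y₂ y₃ : ℚ} → x₁ ≡ y₁ → x₂ ≡ y₂ → x₃ ≡ y₃ → (x₁ , x₂ , x₃) ≡ (y₁ , y₂ , y₃)
≡³ = cong₃ (λ x y z → (x , y , z))

•-zeroˡ : ∀ x → 0ℚ • x ≡ 0³
•-zeroˡ (x₁ , x₂ , x₃) = ≡³ (ℚP.*-zeroˡ x₁) (ℚP.*-zeroˡ x₂) (ℚP.*-zeroˡ x₃)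

•-cancelˡ : ∀ {κ x y} → κ ≢ 0ℚ → κ • x ≡ κ • y → x ≡ y
•-cancelˡ {κ} {x₁ , x₂ , x₃} {y₁ , y₂ , y₃} κ≢0 eq =
  ≡³ (cancel (cong proj₁ eq)) (cancel (cong (proj₁ ∘ proj₂) eq)) (cancel (cong (proj₂ ∘ proj₂) eq))
  where
  instance _ = ℚ.≢-nonZero κ≢0
  1/κ*[κ*s]≡s : ∀ s → 1/ κ * (κ * s) ≡ s
  1/κ*[κ*s]≡s s = trans (sym (ℚP.*-assoc (1/ κ) κ s)) (trans (cong (_* s) (ℚP.*-inverseˡ κ)) (ℚP.*-identityˡ s))
  cancel : ∀ {s t} → κ * s ≡ κ * t → s ≡ t
  cancel {s} {t} e = trans (sym (1/κ*[κ*s]≡s s)) (trans (cong (1/ κ *_) e) (1/κ*[κ*s]≡s t))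

-- The dual basis of (a, b, c) is (b ⨯ c, c ⨯ a, a ⨯ b) scaled by 1 / det a b c.
cramer : ∀ a b c x → det a b c • x ≡
  ((x · b ⨯ c) • a) +³ (((x · c ⨯ a) • b) +³ ((x · a ⨯ b) • c))
cramer (a₁ , a₂ , a₃) (b₁ , b₂ , b₃) (c₁ , c₂ , c₃) (x₁ , x₂ , x₃) =
  ≡³ (coord₁ a₁ a₂ a₃ b₁ b₂ b₃ c₁ c₂ c₃ x₁ x₂ x₃)
     (coord₂ a₁ a₂ a₃ b₁ b₂ b₃ c₁ c₂ c₃ x₁ x₂ x₃)
     (coord₃ a₁ a₂ a₃ b₁ b₂ b₃ c₁ c₂ c₃ x₁ x₂ x₃)
  where
  coord₁ : ∀ a₁ a₂ a₃ b₁ b₂ b₃ c₁ c₂ c₃ x₁ x₂ x₃ →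
    (a₁ * (b₂ * c₃ - b₃ * c₂) + a₂ * (b₃ * c₁ - b₁ * c₃) + a₃ * (b₁ * c₂ - b₂ * c₁)) * x₁ ≡
      (x₁ * (b₂ * c₃ - b₃ * c₂) + x₂ * (b₃ * c₁ - b₁ * c₃) + x₃ * (b₁ * c₂ - b₂ * c₁)) * a₁
      + ((x₁ * (c₂ * a₃ - c₃ * a₂) + x₂ * (c₃ * a₁ - c₁ * a₃) + x₃ * (c₁ * a₂ - c₂ * a₁)) * b₁
      +  (x₁ * (a₂ * b₃ - a₃ * b₂) + x₂ * (a₃ * b₁ - a₁ * b₃) + x₃ * (a₁ * b₂ - a₂ * b₁)) * c₁)
  coord₁ = solve-∀ ℚ-ring
  coord₂ : ∀ a₁ a₂ a₃ b₁ b₂ b₃ c₁ c₂ c₃ x₁ x₂ x₃ →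
    (a₁ * (b₂ * c₃ - b₃ * c₂) + a₂ * (b₃ * c₁ - b₁ * c₃) + a₃ * (b₁ * c₂ - b₂ * c₁)) * x₂ ≡
      (x₁ * (b₂ * c₃ - b₃ * c₂) + x₂ * (b₃ * c₁ - b₁ * c₃) + x₃ * (b₁ * c₂ - b₂ * c₁)) * a₂
      + ((x₁ * (c₂ * a₃ - c₃ * a₂) + x₂ * (c₃ * a₁ - c₁ * a₃) + x₃ * (c₁ * a₂ - c₂ * a₁)) * b₂
      +  (x₁ * (a₂ * b₃ - a₃ * b₂) + x₂ * (a₃ * b₁ - a₁ * b₃) + x₃ * (a₁ * b₂ - a₂ * b₁)) * c₂)
  coord₂ = solve-∀ ℚ-ring
  coord₃ : ∀ a₁ a₂ a₃ b₁ b₂ b₃ c₁ c₂ c₃ x₁ x₂ x₃ →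
    (a₁ * (b₂ * c₃ - b₃ * c₂) + a₂ * (b₃ * c₁ - b₁ * c₃) + a₃ * (b₁ * c₂ - b₂ * c₁)) * x₃ ≡
      (x₁ * (b₂ * c₃ - b₃ * c₂) + x₂ * (b₃ * c₁ - b₁ * c₃) + x₃ * (b₁ * c₂ - b₂ * c₁)) * a₃
      + ((x₁ * (c₂ * a₃ - c₃ * a₂) + x₂ * (c₃ * a₁ - c₁ * a₃) + x₃ * (c₁ * a₂ - c₂ * a₁)) * b₃
      +  (x₁ * (a₂ * b₃ - a₃ * b₂) + x₂ * (a₃ * b₁ - a₁ * b₃) + x₃ * (a₁ * b₂ - a₂ * b₁)) * c₃)
  coord₃ = solve-∀ ℚ-ring

·-nondegenerate : ∀ {y} → (∀ x → x · y ≡ 0ℚ) → y ≡ 0³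
·-nondegenerate {y₁ , y₂ , y₃} ⊥y =
  ≡³ (trans (sym (pick₁ y₁ y₂ y₃)) (⊥y (1ℚ , 0ℚ , 0ℚ)))
     (trans (sym (pick₂ y₁ y₂ y₃)) (⊥y (0ℚ , 1ℚ , 0ℚ)))
     (trans (sym (pick₃ y₁ y₂ y₃)) (⊥y (0ℚ , 0ℚ , 1ℚ)))
  where
  pick₁ : ∀ y₁ y₂ y₃ → 1ℚ * y₁ + 0ℚ * y₂ + 0ℚ * y₃ ≡ y₁
  pick₁ = solve-∀ ℚ-ring
  pick₂ : ∀ y₁ y₂ y₃ → 0ℚ * y₁ + 1ℚ * y₂ + 0ℚ * y₃ ≡ y₂
  pick₂ = solve-∀ ℚ-ring
  pick₃ : ∀ y₁ y₂ y₃ → 0ℚ * y₁ + 0ℚ * y₂ + 1ℚ * y₃ ≡ y₃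
  pick₃ = solve-∀ ℚ-ring

LinIndepℚ-rotate : ∀ {a b c} → LinIndepℚ a b c → LinIndepℚ (rotate a) (rotate b) (rotate c)
LinIndepℚ-rotate indep α β γ eq = indep α β γ (cong (rotate ∘ rotate) eq)

-- The combination (- b₁) a + a₁ b has coordinates 0, (a ⨯ b)₃ and - (a ⨯ b)₂.
⨯≡0⇒proj₁≡0 : ∀ {a b c} → a ⨯ b ≡ 0³ → LinIndepℚ a b c → proj₁ a ≡ 0ℚ
⨯≡0⇒proj₁≡0 {a₁ , a₂ , a₃} {b₁ , b₂ , b₃} {c₁ , c₂ , c₃} a⨯b≡0 indep =
  proj₁ (proj₂ (indep (- b₁) a₁ 0ℚ (≡³
    (coord₁ a₁ b₁ c₁)
    (trans (coord₂ a₁ a₂ b₁ b₂ c₂) (cong (proj₂ ∘ proj₂) a⨯b≡0))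
    (trans (coord₃ a₁ a₃ b₁ b₃ c₃) (cong (-_ ∘ proj₁ ∘ proj₂) a⨯b≡0)))))
  where
  coord₁ : ∀ a₁ b₁ c₁ → - b₁ * a₁ + (a₁ * b₁ + 0ℚ * c₁) ≡ 0ℚ
  coord₁ = solve-∀ ℚ-ring
  coord₂ : ∀ a₁ a₂ b₁ b₂ c₂ → - b₁ * a₂ + (a₁ * b₂ + 0ℚ * c₂) ≡ a₁ * b₂ - a₂ * b₁
  coord₂ = solve-∀ ℚ-ring
  coord₃ : ∀ a₁ a₃ b₁ b₃ c₃ → - b₁ * a₃ + (a₁ * b₃ + 0ℚ * c₃) ≡ - (a₃ * b₁ - a₁ * b₃)
  coord₃ = solve-∀ ℚ-ring

⨯≡0⇒dependent : ∀ {a b c} → a ⨯ b ≡ 0³ → ¬ LinIndepℚ a b c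
⨯≡0⇒dependent {a} {b} {c} a⨯b≡0 indep = 1≢0 (proj₁ (indep 1ℚ 0ℚ 0ℚ (begin
  (1ℚ • a) +³ ((0ℚ • b) +³ (0ℚ • c)) ≡⟨ cong₃ (λ x y z → (1ℚ • x) +³ (y +³ z)) a≡0 (•-zeroˡ b) (•-zeroˡ c) ⟩
  (1ℚ • 0³) +³ (0³ +³ 0³)             ≡⟨⟩
  0³                                  ∎)))
  where
  open ≡-Reasoning
  a≡0 : a ≡ 0³
  a≡0 = ≡³ (⨯≡0⇒proj₁≡0 a⨯b≡0 indep)
           (⨯≡0⇒proj₁≡0 (cong rotate a⨯b≡0) (LinIndepℚ-rotate indep))
           (⨯≡0⇒proj₁≡0 (cong (rotate ∘ rotate) a⨯b≡0) (LinIndepℚ-rotate (LinIndepℚ-rotate indep)))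
  1≢0 : 1ℚ ≢ 0ℚ
  1≢0 ()

det≢0 : ∀ {a b c} → LinIndepℚ a b c → det a b c ≢ 0ℚ
det≢0 {a} {b} {c} indep det≡0 = ⨯≡0⇒dependent (·-nondegenerate x·a⨯b≡0) indep
  where
  x·a⨯b≡0 : ∀ x → x · a ⨯ b ≡ 0ℚ
  x·a⨯b≡0 x = proj₂ (proj₂ (indep (x · b ⨯ c) (x · c ⨯ a) (x · a ⨯ b) (begin
    ((x · b ⨯ c) • a) +³ (((x · c ⨯ a) • b) +³ ((x · a ⨯ b) • c)) ≡⟨ cramer a b c x ⟨
    det a b c • x                                                  ≡⟨ cong (_• x) det≡0 ⟩
    0ℚ • x                                                         ≡⟨ •-zeroˡ x ⟩
    0³                                                             ∎)))
    where open ≡-Reasoning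

det-injective : ∀ {a b c} → LinIndepℚ a b c → ∀ {p q} →
  p · b ⨯ c ≡ q · b ⨯ c → p · c ⨯ a ≡ q · c ⨯ a → p · a ⨯ b ≡ q · a ⨯ b → p ≡ q
det-injective {a} {b} {c} indep {p} {q} e₁ e₂ e₃ = •-cancelˡ (det≢0 indep) (begin
  det a b c • p                                                   ≡⟨ cramer a b c p ⟩
  ((p · b ⨯ c) • a) +³ (((p · c ⨯ a) • b) +³ ((p · a ⨯ b) • c))   ≡⟨ cong₃ combination e₁ e₂ e₃ ⟩
  ((q · b ⨯ c) • a) +³ (((q · c ⨯ a) • b) +³ ((q · a ⨯ b) • c))   ≡⟨ cramer a b c q ⟨
  det a b c • q                                                   ∎)
  where
  open ≡-Reasoning
  combination : ℚ → ℚ → ℚ → Q3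
  combination α β γ = (α • a) +³ ((β • b) +³ (γ • c))

·-along-line : ∀ B t κ V N → (B +³ (t • (κ • V))) · N ≡ B · N + (t * κ) * (V · N)
·-along-line (b₁ , b₂ , b₃) t κ (v₁ , v₂ , v₃) (n₁ , n₂ , n₃) = expand b₁ b₂ b₃ t κ v₁ v₂ v₃ n₁ n₂ n₃
  where
  expand : ∀ b₁ b₂ b₃ t κ v₁ v₂ v₃ n₁ n₂ n₃ →
    (b₁ + t * (κ * v₁)) * n₁ + (b₂ + t * (κ * v₂)) * n₂ + (b₃ + t * (κ * v₃)) * n₃ ≡
    b₁ * n₁ + b₂ * n₂ + b₃ * n₃ + (t * κ) * (v₁ * n₁ + v₂ * n₂ + v₃ * n₃)
  expand = solve-∀ ℚ-ring

·⨯-selfˡ : ∀ V W → V · V ⨯ W ≡ 0ℚ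
·⨯-selfˡ (v₁ , v₂ , v₃) (w₁ , w₂ , w₃) = expand v₁ v₂ v₃ w₁ w₂ w₃
  where
  expand : ∀ v₁ v₂ v₃ w₁ w₂ w₃ →
    v₁ * (v₂ * w₃ - v₃ * w₂) + v₂ * (v₃ * w₁ - v₁ * w₃) + v₃ * (v₁ * w₂ - v₂ * w₁) ≡ 0ℚ
  expand = solve-∀ ℚ-ring

·⨯-selfʳ : ∀ V W → V · W ⨯ V ≡ 0ℚ
·⨯-selfʳ (v₁ , v₂ , v₃) (w₁ , w₂ , w₃) = expand v₁ v₂ v₃ w₁ w₂ w₃
  where
  expand : ∀ v₁ v₂ v₃ w₁ w₂ w₃ →
    v₁ * (w₂ * v₃ - w₃ * v₂) + v₂ * (w₃ * v₁ - w₁ * v₃) + v₃ * (w₁ * v₂ - w₂ * v₁) ≡ 0ℚ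
  expand = solve-∀ ℚ-ring

OnLine⇒·≡base· : ∀ ℓ κ V N {x} → dir ℓ ≡ κ • V → V · N ≡ 0ℚ → x OnLine ℓ → x · N ≡ base ℓ · N
OnLine⇒·≡base· (line B _) κ V N refl V⊥N (t , refl) = begin
  (B +³ (t • (κ • V))) · N     ≡⟨ ·-along-line B t κ V N ⟩
  B · N + (t * κ) * (V · N)    ≡⟨ cong (λ z → B · N + (t * κ) * z) V⊥N ⟩
  B · N + (t * κ) * 0ℚ         ≡⟨ cong (_+_ (B · N)) (ℚP.*-zeroʳ (t * κ)) ⟩
  B · N + 0ℚ                   ≡⟨ ℚP.+-identityʳ (B · N) ⟩
  B · N                        ∎
  where open ≡-Reasoning

·-const-on-line : ∀ ℓ v N {x y} → ParallelTo ℓ v → toQ3 v · N ≡ 0ℚ →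
  x OnLine ℓ → y OnLine ℓ → x · N ≡ y · N
·-const-on-line ℓ v N (κ , _ , d) v⊥N x∈ℓ y∈ℓ =
  trans (OnLine⇒·≡base· ℓ κ (toQ3 v) N d v⊥N x∈ℓ) (sym (OnLine⇒·≡base· ℓ κ (toQ3 v) N d v⊥N y∈ℓ))

private
  shift-parameter : ∀ b b′ s s′ t κ κ′ μ v → μ * κ′ ≡ 1ℚ → b + s * (κ * v) ≡ b′ + s′ * (κ′ * v) →
    b + t * (κ * v) ≡ b′ + (s′ + (t - s) * κ * μ) * (κ′ * v)
  shift-parameter b b′ s s′ t κ κ′ μ v μκ′≡1 meet = begin
    b + t * (κ * v)                                  ≡⟨ split b s t κ v ⟩
    (b + s * (κ * v)) + ((t - s) * κ * 1ℚ) * v       ≡⟨ cong₂ (λ p q → p + ((t - s) * κ * q) * v) meet (sym μκ′≡1) ⟩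
    (b′ + s′ * (κ′ * v)) + ((t - s) * κ * (μ * κ′)) * v ≡⟨ merge b′ s s′ t κ κ′ μ v ⟩
    b′ + (s′ + (t - s) * κ * μ) * (κ′ * v)           ∎
    where
    open ≡-Reasoning
    split : ∀ b s t κ v → b + t * (κ * v) ≡ (b + s * (κ * v)) + ((t - s) * κ * 1ℚ) * v
    split = solve-∀ ℚ-ring
    merge : ∀ b′ s s′ t κ κ′ μ v →
      (b′ + s′ * (κ′ * v)) + ((t - s) * κ * (μ * κ′)) * v ≡ b′ + (s′ + (t - s) * κ * μ) * (κ′ * v)
    merge = solve-∀ ℚ-ring

-- Reparametrise ℓ′ so that it reaches every point of ℓ: t ↦ s′ + (t - s) κ / κ′.
meeting-⊆ : ∀ ℓ ℓ′ κ κ′ V → κ′ ≢ 0ℚ → dir ℓ ≡ κ • V → dir ℓ′ ≡ κ′ • V →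
  Intersect ℓ ℓ′ → ∀ {y} → y OnLine ℓ → y OnLine ℓ′
meeting-⊆ (line (b₁ , b₂ , b₃) _) (line (b₁′ , b₂′ , b₃′) _) κ κ′ (v₁ , v₂ , v₃) κ′≢0 refl refl
  (_ , (s , refl) , (s′ , meet)) (t , refl) =
  s′ + (t - s) * κ * 1/ κ′ ,
  ≡³ (shift-parameter b₁ b₁′ s s′ t κ κ′ (1/ κ′) v₁ μκ′≡1 (cong proj₁ meet))
     (shift-parameter b₂ b₂′ s s′ t κ κ′ (1/ κ′) v₂ μκ′≡1 (cong (proj₁ ∘ proj₂) meet))
     (shift-parameter b₃ b₃′ s s′ t κ κ′ (1/ κ′) v₃ μκ′≡1 (cong (proj₂ ∘ proj₂) meet))
  where
  instance _ = ℚ.≢-nonZero κ′≢0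
  μκ′≡1 : 1/ κ′ * κ′ ≡ 1ℚ
  μκ′≡1 = ℚP.*-inverseˡ κ′

parallel-meeting⇒SameLine : ∀ {ℓ ℓ′ v} → ParallelTo ℓ v → ParallelTo ℓ′ v → Intersect ℓ ℓ′ → SameLine ℓ ℓ′
parallel-meeting⇒SameLine {ℓ} {ℓ′} {v} (κ , κ≢0 , d) (κ′ , κ′≢0 , d′) (x , x∈ℓ , x∈ℓ′) _ =
  mk⇔ (meeting-⊆ ℓ ℓ′ κ κ′ (toQ3 v) κ′≢0 d d′ (x , x∈ℓ , x∈ℓ′))
      (meeting-⊆ ℓ′ ℓ κ′ κ (toQ3 v) κ≢0 d′ d (x , x∈ℓ′ , x∈ℓ))

concurrent : ∀ {ℓ₁ ℓ₂ ℓ₃ v₁ v₂ v₃} → ParallelTo ℓ₁ v₁ → ParallelTo ℓ₂ v₂ → ParallelTo ℓ₃ v₃ →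
  LinIndep v₁ v₂ v₃ → Intersect ℓ₁ ℓ₂ → Intersect ℓ₂ ℓ₃ → Intersect ℓ₁ ℓ₃ →
  ∃ λ P → P OnLine ℓ₁ × P OnLine ℓ₂ × P OnLine ℓ₃
concurrent {ℓ₁} {ℓ₂} {ℓ₃} {v₁} {v₂} {v₃} ∥₁ ∥₂ ∥₃ indep
  (P₁₂ , P₁₂∈ℓ₁ , P₁₂∈ℓ₂) (P₂₃ , P₂₃∈ℓ₂ , P₂₃∈ℓ₃) (P₁₃ , P₁₃∈ℓ₁ , P₁₃∈ℓ₃) =
  P₁₂ , P₁₂∈ℓ₁ , P₁₂∈ℓ₂ , subst (_OnLine ℓ₃) (sym P₁₂≡P₁₃) P₁₃∈ℓ₃
  where
  V₁ = toQ3 v₁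
  V₂ = toQ3 v₂
  V₃ = toQ3 v₃
  -- Against V₃ ⨯ V₁ and V₁ ⨯ V₂ both points are on ℓ₁; against V₂ ⨯ V₃ they meet through P₂₃.
  P₁₂≡P₁₃ : P₁₂ ≡ P₁₃
  P₁₂≡P₁₃ = det-injective indep
    (trans (·-const-on-line ℓ₂ v₂ (V₂ ⨯ V₃) ∥₂ (·⨯-selfˡ V₂ V₃) P₁₂∈ℓ₂ P₂₃∈ℓ₂)
           (·-const-on-line ℓ₃ v₃ (V₂ ⨯ V₃) ∥₃ (·⨯-selfʳ V₃ V₂) P₂₃∈ℓ₃ P₁₃∈ℓ₃))
    (·-const-on-line ℓ₁ v₁ (V₃ ⨯ V₁) ∥₁ (·⨯-selfʳ V₁ V₃) P₁₂∈ℓ₁ P₁₃∈ℓ₁)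
    (·-const-on-line ℓ₁ v₁ (V₁ ⨯ V₂) ∥₁ (·⨯-selfˡ V₁ V₂) P₁₂∈ℓ₁ P₁₃∈ℓ₁)

infix 7 _·ℤ_
infix 8 _⨯ℤ_

_·ℤ_ : Z3 → Z3 → ℤ
(x₁ , x₂ , x₃) ·ℤ (y₁ , y₂ , y₃) = x₁ ℤ.* y₁ ℤ.+ x₂ ℤ.* y₂ ℤ.+ x₃ ℤ.* y₃

_⨯ℤ_ : Z3 → Z3 → Z3
(x₁ , x₂ , x₃) ⨯ℤ (y₁ , y₂ , y₃) =
  (x₂ ℤ.* y₃ ℤ.- x₃ ℤ.* y₂ , x₃ ℤ.* y₁ ℤ.- x₁ ℤ.* y₃ , x₁ ℤ.* y₂ ℤ.- x₂ ℤ.* y₁)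

ι-homo-·ℤ : ∀ u v → ι (u ·ℤ v) ≡ toQ3 u · toQ3 v
ι-homo-·ℤ (x₁ , x₂ , x₃) (y₁ , y₂ , y₃) =
  trans (ι-homo-+ (x₁ ℤ.* y₁ ℤ.+ x₂ ℤ.* y₂) (x₃ ℤ.* y₃))
        (cong₂ _+_ (trans (ι-homo-+ (x₁ ℤ.* y₁) (x₂ ℤ.* y₂)) (cong₂ _+_ (ι-homo-* x₁ y₁) (ι-homo-* x₂ y₂)))
                   (ι-homo-* x₃ y₃))

toQ3-homo-⨯ℤ : ∀ u v → toQ3 (u ⨯ℤ v) ≡ toQ3 u ⨯ toQ3 v
toQ3-homo-⨯ℤ (x₁ , x₂ , x₃) (y₁ , y₂ , y₃) = ≡³ (minor x₂ y₃ x₃ y₂) (minor x₃ y₁ x₁ y₃) (minor x₁ y₂ x₂ y₁)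
  where
  minor : ∀ a b c d → ι (a ℤ.* b ℤ.- c ℤ.* d) ≡ ι a * ι b - ι c * ι d
  minor a b c d = trans (ι-homo-sub (a ℤ.* b) (c ℤ.* d)) (cong₂ _-_ (ι-homo-* a b) (ι-homo-* c d))

ι-triple : ∀ c v w → ι (c ·ℤ v ⨯ℤ w) ≡ toQ3 c · toQ3 v ⨯ toQ3 w
ι-triple c v w = trans (ι-homo-·ℤ c (v ⨯ℤ w)) (cong (toQ3 c ·_) (toQ3-homo-⨯ℤ v w))

Bounded : ℕ → Z3 → Set
Bounded n (x₁ , x₂ , x₃) = ∣ x₁ ∣ ≤ n × ∣ x₂ ∣ ≤ n × ∣ x₃ ∣ ≤ n

∣triple∣≤ : ∀ {C V W} c v w → Bounded C c → Bounded V v → Bounded W w →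
  ∣ c ·ℤ v ⨯ℤ w ∣ ≤ 6 ℕ.* (C ℕ.* (V ℕ.* W))
∣triple∣≤ {C} {V} {W} (c₁ , c₂ , c₃) (v₁ , v₂ , v₃) (w₁ , w₂ , w₃)
  (c₁≤ , c₂≤ , c₃≤) (v₁≤ , v₂≤ , v₃≤) (w₁≤ , w₂≤ , w₃≤) = begin
  ∣ t₁ ℤ.+ t₂ ℤ.+ t₃ ∣                ≤⟨ ∣i+j+k∣≤ t₁ t₂ t₃ ⟩
  ∣ t₁ ∣ ℕ.+ ∣ t₂ ∣ ℕ.+ ∣ t₃ ∣         ≤⟨ ℕP.+-mono-≤ (ℕP.+-mono-≤ (term c₁ v₂ w₃ v₃ w₂ c₁≤ v₂≤ w₃≤ v₃≤ w₂≤)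
                                                                  (term c₂ v₃ w₁ v₁ w₃ c₂≤ v₃≤ w₁≤ v₁≤ w₃≤))
                                                   (term c₃ v₁ w₂ v₂ w₁ c₃≤ v₁≤ w₂≤ v₂≤ w₁≤) ⟩
  C ℕ.* (V ℕ.* W ℕ.+ V ℕ.* W) ℕ.+ C ℕ.* (V ℕ.* W ℕ.+ V ℕ.* W) ℕ.+ C ℕ.* (V ℕ.* W ℕ.+ V ℕ.* W)
                                      ≡⟨ sum-of-three C V W ⟩
  6 ℕ.* (C ℕ.* (V ℕ.* W))             ∎
  where
  open ℕP.≤-Reasoning
  t₁ = c₁ ℤ.* (v₂ ℤ.* w₃ ℤ.- v₃ ℤ.* w₂)
  t₂ = c₂ ℤ.* (v₃ ℤ.* w₁ ℤ.- v₁ ℤ.* w₃)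
  t₃ = c₃ ℤ.* (v₁ ℤ.* w₂ ℤ.- v₂ ℤ.* w₁)
  sum-of-three : ∀ C V W → C ℕ.* (V ℕ.* W ℕ.+ V ℕ.* W) ℕ.+ C ℕ.* (V ℕ.* W ℕ.+ V ℕ.* W) ℕ.+ C ℕ.* (V ℕ.* W ℕ.+ V ℕ.* W)
    ≡ 6 ℕ.* (C ℕ.* (V ℕ.* W))
  sum-of-three = ℕ-Solver.solve-∀
  ∣i+j+k∣≤ : ∀ i j k → ∣ i ℤ.+ j ℤ.+ k ∣ ≤ ∣ i ∣ ℕ.+ ∣ j ∣ ℕ.+ ∣ k ∣
  ∣i+j+k∣≤ i j k = ℕP.≤-trans (ℤP.∣i+j∣≤∣i∣+∣j∣ (i ℤ.+ j) k) (ℕP.+-monoˡ-≤ ∣ k ∣ (ℤP.∣i+j∣≤∣i∣+∣j∣ i j))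
  term : ∀ i j k l m → ∣ i ∣ ≤ C → ∣ j ∣ ≤ V → ∣ k ∣ ≤ W → ∣ l ∣ ≤ V → ∣ m ∣ ≤ W →
    ∣ i ℤ.* (j ℤ.* k ℤ.- l ℤ.* m) ∣ ≤ C ℕ.* (V ℕ.* W ℕ.+ V ℕ.* W)
  term i j k l m i≤ j≤ k≤ l≤ m≤ = begin
    ∣ i ℤ.* (j ℤ.* k ℤ.- l ℤ.* m) ∣             ≡⟨ ℤP.∣i*j∣≡∣i∣*∣j∣ i _ ⟩
    ∣ i ∣ ℕ.* ∣ j ℤ.* k ℤ.- l ℤ.* m ∣
      ≤⟨ ℕP.*-monoʳ-≤ ∣ i ∣ (ℤP.∣i-j∣≤∣i∣+∣j∣ (j ℤ.* k) (l ℤ.* m)) ⟩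
    ∣ i ∣ ℕ.* (∣ j ℤ.* k ∣ ℕ.+ ∣ l ℤ.* m ∣)
      ≡⟨ cong₂ (λ p q → ∣ i ∣ ℕ.* (p ℕ.+ q)) (ℤP.∣i*j∣≡∣i∣*∣j∣ j k) (ℤP.∣i*j∣≡∣i∣*∣j∣ l m) ⟩
    ∣ i ∣ ℕ.* (∣ j ∣ ℕ.* ∣ k ∣ ℕ.+ ∣ l ∣ ℕ.* ∣ m ∣)
      ≤⟨ ℕP.*-mono-≤ i≤ (ℕP.+-mono-≤ (ℕP.*-mono-≤ j≤ k≤) (ℕP.*-mono-≤ l≤ m≤)) ⟩
    C ℕ.* (V ℕ.* W ℕ.+ V ℕ.* W)                 ∎

-- Counting through an injective code

encodeℤ : ∀ {B} (i : ℤ) → ∣ i ∣ ≤ B → Fin (2 ℕ.* suc B)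
encodeℤ {B} (+ n)    n≤B = combine {2} {suc B} zero       (fromℕ< (s≤s n≤B))
encodeℤ {B} -[1+ n ] n≤B = combine {2} {suc B} (suc zero) (fromℕ< (s≤s n≤B))

encodeℤ-injective : ∀ {B} i j (i≤B : ∣ i ∣ ≤ B) (j≤B : ∣ j ∣ ≤ B) → encodeℤ i i≤B ≡ encodeℤ j j≤B → i ≡ j
encodeℤ-injective {B} (+ m) (+ n) m≤B n≤B eq
  with refl ← FinP.fromℕ<-injective m n (s≤s m≤B) (s≤s n≤B)
                (FinP.combine-injectiveʳ {m = 2} {n = suc B} zero (fromℕ< (s≤s m≤B)) zero (fromℕ< (s≤s n≤B)) eq)
  = refl
encodeℤ-injective {B} -[1+ m ] -[1+ n ] m≤B n≤B eq
  with refl ← FinP.fromℕ<-injective (suc m) (suc n) (s≤s m≤B) (s≤s n≤B)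
                (FinP.combine-injectiveʳ {m = 2} {n = suc B} (suc zero) (fromℕ< (s≤s m≤B)) (suc zero) (fromℕ< (s≤s n≤B)) eq)
  = refl
encodeℤ-injective {B} (+ m) -[1+ n ] m≤B n≤B eq
  with () ← FinP.combine-injectiveˡ {m = 2} {n = suc B} zero (fromℕ< (s≤s m≤B)) (suc zero) (fromℕ< (s≤s n≤B)) eq
encodeℤ-injective {B} -[1+ m ] (+ n) m≤B n≤B eq
  with () ← FinP.combine-injectiveˡ {m = 2} {n = suc B} (suc zero) (fromℕ< (s≤s m≤B)) zero (fromℕ< (s≤s n≤B)) eq

combine₃ : ∀ {a b c} → Fin a → Fin b → Fin c → Fin (a ℕ.* (b ℕ.* c))
combine₃ i j k = combine i (combine j k)

combine₃-injective : ∀ {a b c} {i i′ : Fin a} {j j′ : Fin b} {k k′ : Fin c} →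
  combine₃ i j k ≡ combine₃ i′ j′ k′ → i ≡ i′ × j ≡ j′ × k ≡ k′
combine₃-injective {i = i} {i′} {j} {j′} {k} {k′} eq
  with refl , eq′ ← FinP.combine-injective i (combine j k) i′ (combine j′ k′) eq
  with refl , refl ← FinP.combine-injective j k j′ k′ eq′ = refl , refl , refl

AllPairs-lookup : ∀ {A : Set} {R : A → A → Set} {xs} → AllPairs R xs →
  ∀ {i j : Fin (length xs)} → i Fin.< j → R (lookup xs i) (lookup xs j)
AllPairs-lookup (Rx ∷ _)   {zero}  {suc j} _         = All.lookup Rx (∈-lookup j)
AllPairs-lookup (_ ∷ Rxs)  {suc i} {suc j} (s≤s i<j) = AllPairs-lookup Rxs i<j

length≤-by-code : ∀ {A : Set} {P : A → Set} {R : A → A → Set} {m} (code : ∀ {x} → P x → Fin m) →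
  (∀ {x y} (px : P x) (py : P y) → code px ≡ code py → R x y) →
  ∀ {xs} → All P xs → AllPairs (λ x y → ¬ R x y) xs → length xs ≤ m
length≤-by-code {m = m} code code-injective {xs} pxs distinct with length xs ≤? m
... | yes ≤m = ≤m
... | no ≰m
  with i , j , i<j , same ← FinP.pigeonhole (ℕP.≰⇒> ≰m) (λ i → code (All.lookup pxs (∈-lookup i)))
  = contradiction (code-injective _ _ same) (AllPairs-lookup distinct i<j)

-[i/d]-nonNeg : ∀ {i} d → i ℤ.≤ 0ℤ → 0ℤ ℤ.≤ ℤ.- (i ℤ./ + suc d)
-[i/d]-nonNeg {i} d i≤0 = ℤP.neg-mono-≤ (ℤP.*-cancelʳ-≤-pos (i ℤ./ + suc d) 0ℤ (+ suc d) (begin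
  i ℤ./ + suc d ℤ.* + suc d   ≤⟨ ℤD.[n/d]*d≤n i (+ suc d) ⟩
  i                           ≤⟨ i≤0 ⟩
  0ℤ                          ≡⟨ ℤP.*-zeroˡ (+ suc d) ⟨
  0ℤ ℤ.* + suc d              ∎))
  where open ℤP.≤-Reasoning

⌈⌉-nonNeg : ∀ p → 0ℚ ℚ.≤ p → 0ℤ ℤ.≤ ℚ.⌈ p ⌉
⌈⌉-nonNeg (mkℚ (+ zero) d _) _          = -[i/d]-nonNeg d ℤP.≤-refl
⌈⌉-nonNeg (mkℚ +[1+ n ] d _) _          = -[i/d]-nonNeg d ℤ.-≤+
⌈⌉-nonNeg (mkℚ -[1+ n ] d _) (ℚ.*≤* ())

/1≤/⇒*≤ : ∀ m k d .{{_ : ℕ.NonZero d}} → (+ m / 1) ℚ.≤ (+ k / d) → m ℕ.* d ≤ k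
/1≤/⇒*≤ m k (suc d) m≤k/d with ℚᵘP.≤-respʳ-≃ (ℚP.toℚᵘ-fromℚᵘ (mkℚᵘ (+ k) d))
                                 (ℚᵘP.≤-respˡ-≃ (toℚᵘ-ι (+ m)) (ℚP.toℚᵘ-mono-≤ m≤k/d))
... | *≤* m*d≤k*1 = ℤP.drop‿+≤+ (subst₂ ℤ._≤_ (sym (ℤP.pos-* m (suc d))) (ℤP.*-identityʳ (+ k)) m*d≤k*1)

*≤⇒≤/ : ∀ {m k} d .{{_ : ℕ.NonZero d}} → m ℕ.* d ≤ k → m ≤ k ℕ./ d
*≤⇒≤/ {m} d m*d≤k = ℕP.≤-trans (ℕP.≤-reflexive (sym (ℕD.m*n/n≡m m d))) (ℕD./-monoˡ-≤ d m*d≤k)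

VecOK⇒Bounded : ∀ {ε k r v} → 0ℚ ℚ.< ε → VecOK ε k (suc r) v → Bounded (k ℕ./ (2 ℕ.* suc r)) v
VecOK⇒Bounded {ε} {k} {r} 0<ε (x-ok , y-ok , z-ok) = coordinate x-ok , coordinate y-ok , coordinate z-ok
  where
  N = Nval k (suc r)
  instance
    _ = ℚP.pos⇒nonNeg ε {{ℚ.positive 0<ε}}
    _ = ℚP.normalize-nonNeg k (2 ℕ.* suc r)
  0≤εN : 0ℚ ℚ.≤ ε ℚ.* N
  0≤εN = ℚP.nonNegative⁻¹ (ε ℚ.* N) {{ℚP.nonNeg*nonNeg⇒nonNeg ε N}}
  coordinate : ∀ {x} → CoordOK ε k (suc r) x → ∣ x ∣ ≤ k ℕ./ (2 ℕ.* suc r)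
  coordinate {+ m}      (_ , x≤N) = *≤⇒≤/ (2 ℕ.* suc r) (/1≤/⇒*≤ m k (2 ℕ.* suc r) x≤N)
  coordinate { -[1+ m ]} (⌈εN⌉≤x , _) = contradiction (ℤP.≤-trans (⌈⌉-nonNeg (ε ℚ.* N) 0≤εN) ⌈εN⌉≤x) λ ()

fromℕ³ : ℕ × ℕ × ℕ → Z3
fromℕ³ (a , b , c) = (+ a , + b , + c)

InCube⇒Bounded : ∀ {k c} → InCube k c → Bounded k (fromℕ³ c)
InCube⇒Bounded ((_ , a≤k) , (_ , b≤k) , (_ , c≤k)) = a≤k , b≤k , c≤k

record Anchor (S : List Z3) (k : ℕ) (ℓ : Line) : Set where
  field
    vec        : Z3
    vec∈S      : vec ∈ S
    parallel   : ParallelTo ℓ vec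
    point      : ℕ × ℕ × ℕ
    point∈cube : InCube k point
    point∈ℓ    : natToQ3 point OnLine ℓ
open Anchor

anchor : ∀ {S k r ℓ} → InL S k (suc r) ℓ → Anchor S k ℓ
anchor ((v , v∈S , ∥) , (c ∷ _ , _ , c∈cube ∷ _ , c∈ℓ ∷ _ , _)) = record
  { vec = v ; vec∈S = v∈S ; parallel = ∥ ; point = c ; point∈cube = c∈cube ; point∈ℓ = c∈ℓ }

height : ∀ {S k ℓ} → Anchor S k ℓ → Z3 → ℤ
height a w = fromℕ³ (point a) ·ℤ vec a ⨯ℤ w

ι-height : ∀ {S k ℓ P} (a : Anchor S k ℓ) w → P OnLine ℓ → ι (height a w) ≡ P · toQ3 (vec a) ⨯ toQ3 w
ι-height {ℓ = ℓ} a w P∈ℓ = trans (ι-triple (fromℕ³ (point a)) (vec a) w)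
  (·-const-on-line ℓ (vec a) (toQ3 (vec a) ⨯ toQ3 w) (parallel a) (·⨯-selfˡ (toQ3 (vec a)) (toQ3 w)) (point∈ℓ a) P∈ℓ)

distinct-directions : ∀ {ℓ ℓ′ v v′} → ParallelTo ℓ v → ParallelTo ℓ′ v′ → ¬ SameLine ℓ ℓ′ → Intersect ℓ ℓ′ → v ≢ v′
distinct-directions {ℓ} {ℓ′} {v} ∥ ∥′ ℓ≉ℓ′ meet refl = ℓ≉ℓ′ (parallel-meeting⇒SameLine {ℓ} {ℓ′} {v} ∥ ∥′ meet)

module Triangles {S : List Z3} (k n r : ℕ) (bounded : All (Bounded n) S)
  (indep : ∀ {u v w} → u ∈ S → v ∈ S → w ∈ S → u ≢ v → v ≢ w → u ≢ w → LinIndep u v w) where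

  record TriangleWitness (ℓ₁ ℓ₂ ℓ₃ : Line) : Set where
    field
      anchor₁     : Anchor S k ℓ₁
      anchor₂     : Anchor S k ℓ₂
      anchor₃     : Anchor S k ℓ₃
      independent : LinIndep (vec anchor₁) (vec anchor₂) (vec anchor₃)
      centre      : Q3
      centre∈ℓ₁   : centre OnLine ℓ₁
      centre∈ℓ₂   : centre OnLine ℓ₂
      centre∈ℓ₃   : centre OnLine ℓ₃

  triangleWitness : ∀ {t} → IsTriangle S k (suc r) t → TriangleWitness (proj₁ t) (proj₁ (proj₂ t)) (proj₂ (proj₂ t))
  triangleWitness {ℓ₁ , ℓ₂ , ℓ₃} (ℓ₁∈L , ℓ₂∈L , ℓ₃∈L , ℓ₁≉ℓ₂ , ℓ₂≉ℓ₃ , ℓ₁≉ℓ₃ , ℓ₁∩ℓ₂ , ℓ₂∩ℓ₃ , ℓ₁∩ℓ₃) =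
    record
      { anchor₁ = a₁ ; anchor₂ = a₂ ; anchor₃ = a₃ ; independent = independent
      ; centre = proj₁ P
      ; centre∈ℓ₁ = proj₁ (proj₂ P) ; centre∈ℓ₂ = proj₁ (proj₂ (proj₂ P)) ; centre∈ℓ₃ = proj₂ (proj₂ (proj₂ P))
      }
    where
    a₁ = anchor ℓ₁∈L
    a₂ = anchor ℓ₂∈L
    a₃ = anchor ℓ₃∈L
    independent : LinIndep (vec a₁) (vec a₂) (vec a₃)
    independent = indep (vec∈S a₁) (vec∈S a₂) (vec∈S a₃)
      (distinct-directions {ℓ₁} {ℓ₂} (parallel a₁) (parallel a₂) ℓ₁≉ℓ₂ ℓ₁∩ℓ₂)
      (distinct-directions {ℓ₂} {ℓ₃} (parallel a₂) (parallel a₃) ℓ₂≉ℓ₃ ℓ₂∩ℓ₃)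
      (distinct-directions {ℓ₁} {ℓ₃} (parallel a₁) (parallel a₃) ℓ₁≉ℓ₃ ℓ₁∩ℓ₃)
    P = concurrent {ℓ₁} {ℓ₂} {ℓ₃} {vec a₁} {vec a₂} {vec a₃}
          (parallel a₁) (parallel a₂) (parallel a₃) independent ℓ₁∩ℓ₂ ℓ₂∩ℓ₃ ℓ₁∩ℓ₃

  heightBound : ℕ
  heightBound = 6 ℕ.* (k ℕ.* (n ℕ.* n))

  ∣height∣≤ : ∀ {ℓ w} (a : Anchor S k ℓ) → w ∈ S → ∣ height a w ∣ ≤ heightBound
  ∣height∣≤ {w = w} a w∈S = ∣triple∣≤ (fromℕ³ (point a)) (vec a) w
    (InCube⇒Bounded (point∈cube a)) (All.lookup bounded (vec∈S a)) (All.lookup bounded w∈S)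

  encodeHeight : ∀ {ℓ ℓ′} → Anchor S k ℓ → Anchor S k ℓ′ → Fin (2 ℕ.* suc heightBound)
  encodeHeight a b = encodeℤ (height a (vec b)) (∣height∣≤ a (vec∈S b))

  encodeHeight-injective : ∀ {ℓ ℓ′ m m′} (a : Anchor S k ℓ) (a′ : Anchor S k ℓ′) (b : Anchor S k m) (b′ : Anchor S k m′) →
    encodeHeight a b ≡ encodeHeight a′ b′ → height a (vec b) ≡ height a′ (vec b′)
  encodeHeight-injective a a′ b b′ = encodeℤ-injective _ _ (∣height∣≤ a (vec∈S b)) (∣height∣≤ a′ (vec∈S b′))

  codeSize : ℕ
  codeSize = (length S ℕ.* (length S ℕ.* length S)) ℕ.* (2 ℕ.* suc heightBound ℕ.* (2 ℕ.* suc heightBound ℕ.* (2 ℕ.* suc heightBound)))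

  module _ {ℓ₁ ℓ₂ ℓ₃} (W : TriangleWitness ℓ₁ ℓ₂ ℓ₃) where
    open TriangleWitness W

    directionCode : Fin (length S ℕ.* (length S ℕ.* length S))
    directionCode = combine₃ (index (vec∈S anchor₁)) (index (vec∈S anchor₂)) (index (vec∈S anchor₃))

    heightCode : Fin (2 ℕ.* suc heightBound ℕ.* (2 ℕ.* suc heightBound ℕ.* (2 ℕ.* suc heightBound)))
    heightCode = combine₃ (encodeHeight anchor₁ anchor₂) (encodeHeight anchor₂ anchor₃) (encodeHeight anchor₃ anchor₁)

    code : Fin codeSize
    code = combine directionCode heightCode

  height≡⇒·⨯≡ : ∀ {ℓ ℓ′ P P′ w w′} (a : Anchor S k ℓ) (a′ : Anchor S k ℓ′) → P OnLine ℓ → P′ OnLine ℓ′ →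
    vec a ≡ vec a′ → w ≡ w′ → height a w ≡ height a′ w′ → P · toQ3 (vec a) ⨯ toQ3 w ≡ P′ · toQ3 (vec a) ⨯ toQ3 w
  height≡⇒·⨯≡ {P = P} {P′} {w} {w′} a a′ P∈ℓ P′∈ℓ′ a≡a′ w≡w′ same = begin
    P · toQ3 (vec a) ⨯ toQ3 w        ≡⟨ ι-height a w P∈ℓ ⟨
    ι (height a w)                   ≡⟨ cong ι same ⟩
    ι (height a′ w′)                 ≡⟨ ι-height a′ w′ P′∈ℓ′ ⟩
    P′ · toQ3 (vec a′) ⨯ toQ3 w′     ≡⟨ cong₂ (λ u z → P′ · toQ3 u ⨯ toQ3 z) a≡a′ w≡w′ ⟨
    P′ · toQ3 (vec a) ⨯ toQ3 w       ∎
    where open ≡-Reasoning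

  anchors-meeting⇒SameLine : ∀ {ℓ ℓ′ P} (a : Anchor S k ℓ) (a′ : Anchor S k ℓ′) → vec a ≡ vec a′ →
    P OnLine ℓ → P OnLine ℓ′ → SameLine ℓ ℓ′
  anchors-meeting⇒SameLine {ℓ} {ℓ′} a a′ a≡a′ P∈ℓ P∈ℓ′ =
    parallel-meeting⇒SameLine {ℓ} {ℓ′} {vec a} (parallel a) (subst (ParallelTo ℓ′) (sym a≡a′) (parallel a′)) (_ , P∈ℓ , P∈ℓ′)

  code-injective : ∀ {ℓ₁ ℓ₂ ℓ₃ ℓ₁′ ℓ₂′ ℓ₃′} (W : TriangleWitness ℓ₁ ℓ₂ ℓ₃) (W′ : TriangleWitness ℓ₁′ ℓ₂′ ℓ₃′) →
    code W ≡ code W′ → SameTriangle (ℓ₁ , ℓ₂ , ℓ₃) (ℓ₁′ , ℓ₂′ , ℓ₃′)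
  code-injective W W′ same =
    (inj₁ (proj₁ ℓ₁≈) , inj₂ (inj₁ (proj₁ ℓ₂≈)) , inj₂ (inj₂ (proj₁ ℓ₃≈))) ,
    (inj₁ (proj₂ ℓ₁≈) , inj₂ (inj₁ (proj₂ ℓ₂≈)) , inj₂ (inj₂ (proj₂ ℓ₃≈)))
    where
    open TriangleWitness W using (independent) renaming (anchor₁ to a₁; anchor₂ to a₂; anchor₃ to a₃; centre to P;
      centre∈ℓ₁ to P∈ℓ₁; centre∈ℓ₂ to P∈ℓ₂; centre∈ℓ₃ to P∈ℓ₃)
    open TriangleWitness W′ using () renaming (anchor₁ to a₁′; anchor₂ to a₂′; anchor₃ to a₃′; centre to P′;
      centre∈ℓ₁ to P′∈ℓ₁′; centre∈ℓ₂ to P′∈ℓ₂′; centre∈ℓ₃ to P′∈ℓ₃′)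
    decoded = FinP.combine-injective (directionCode W) (heightCode W) (directionCode W′) (heightCode W′) same
    same-indices = combine₃-injective (proj₁ decoded)
    same-encodings = combine₃-injective (proj₂ decoded)
    same-vec : ∀ {ℓ ℓ′} (a : Anchor S k ℓ) (a′ : Anchor S k ℓ′) → index (vec∈S a) ≡ index (vec∈S a′) → vec a ≡ vec a′
    same-vec a a′ = Membership.index-injective (setoid Z3) (vec∈S a) (vec∈S a′)
    v₁≡ = same-vec a₁ a₁′ (proj₁ same-indices)
    v₂≡ = same-vec a₂ a₂′ (proj₁ (proj₂ same-indices))
    v₃≡ = same-vec a₃ a₃′ (proj₂ (proj₂ same-indices))
    P≡P′ : P ≡ P′
    P≡P′ = det-injective independent
      (height≡⇒·⨯≡ a₂ a₂′ P∈ℓ₂ P′∈ℓ₂′ v₂≡ v₃≡ (encodeHeight-injective a₂ a₂′ a₃ a₃′ (proj₁ (proj₂ same-encodings))))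
      (height≡⇒·⨯≡ a₃ a₃′ P∈ℓ₃ P′∈ℓ₃′ v₃≡ v₁≡ (encodeHeight-injective a₃ a₃′ a₁ a₁′ (proj₂ (proj₂ same-encodings))))
      (height≡⇒·⨯≡ a₁ a₁′ P∈ℓ₁ P′∈ℓ₁′ v₁≡ v₂≡ (encodeHeight-injective a₁ a₁′ a₂ a₂′ (proj₁ same-encodings)))
    both-ways : ∀ {ℓ ℓ′} (a : Anchor S k ℓ) (a′ : Anchor S k ℓ′) → vec a ≡ vec a′ →
      P OnLine ℓ → P′ OnLine ℓ′ → SameLine ℓ ℓ′ × SameLine ℓ′ ℓ
    both-ways {ℓ} {ℓ′} a a′ a≡a′ P∈ℓ P′∈ℓ′ =
      anchors-meeting⇒SameLine a a′ a≡a′ P∈ℓ (subst (_OnLine ℓ′) (sym P≡P′) P′∈ℓ′) ,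
      anchors-meeting⇒SameLine a′ a (sym a≡a′) P′∈ℓ′ (subst (_OnLine ℓ) P≡P′ P∈ℓ)
    ℓ₁≈ = both-ways a₁ a₁′ v₁≡ P∈ℓ₁ P′∈ℓ₁′
    ℓ₂≈ = both-ways a₂ a₂′ v₂≡ P∈ℓ₂ P′∈ℓ₂′
    ℓ₃≈ = both-ways a₃ a₃′ v₃≡ P∈ℓ₃ P′∈ℓ₃′

  triangle-count : ∀ {Ts} → All (IsTriangle S k (suc r)) Ts → AllPairs (λ t t′ → ¬ SameTriangle t t′) Ts →
    length Ts ≤ codeSize
  triangle-count = length≤-by-code
    (λ {t} t∈T → code (triangleWitness {t} t∈T))
    (λ {t} {t′} t∈T t′∈T → code-injective (triangleWitness {t} t∈T) (triangleWitness {t′} t′∈T))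

heightRange*r²≤5k³ : ∀ k r n → 1 ≤ r → r ≤ k → n ℕ.* (2 ℕ.* r) ≤ k →
  2 ℕ.* suc (6 ℕ.* (k ℕ.* (n ℕ.* n))) ℕ.* (r ℕ.* r) ≤ 5 ℕ.* (k ℕ.* (k ℕ.* k))
heightRange*r²≤5k³ k r n 1≤r r≤k n2r≤k = begin
  2 ℕ.* suc (6 ℕ.* (k ℕ.* (n ℕ.* n))) ℕ.* (r ℕ.* r)
    ≡⟨ expand k r n ⟩
  3 ℕ.* (k ℕ.* ((n ℕ.* (2 ℕ.* r)) ℕ.* (n ℕ.* (2 ℕ.* r)))) ℕ.+ 2 ℕ.* (1 ℕ.* (r ℕ.* r))
    ≤⟨ ℕP.+-mono-≤ (ℕP.*-monoʳ-≤ 3 (ℕP.*-monoʳ-≤ k (ℕP.*-mono-≤ n2r≤k n2r≤k)))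
                   (ℕP.*-monoʳ-≤ 2 (ℕP.*-mono-≤ (ℕP.≤-trans 1≤r r≤k) (ℕP.*-mono-≤ r≤k r≤k))) ⟩
  3 ℕ.* (k ℕ.* (k ℕ.* k)) ℕ.+ 2 ℕ.* (k ℕ.* (k ℕ.* k))
    ≡⟨ ℕP.*-distribʳ-+ (k ℕ.* (k ℕ.* k)) 3 2 ⟨
  5 ℕ.* (k ℕ.* (k ℕ.* k)) ∎
  where
  open ℕP.≤-Reasoning
  expand : ∀ k r n → 2 ℕ.* suc (6 ℕ.* (k ℕ.* (n ℕ.* n))) ℕ.* (r ℕ.* r)
    ≡ 3 ℕ.* (k ℕ.* ((n ℕ.* (2 ℕ.* r)) ℕ.* (n ℕ.* (2 ℕ.* r)))) ℕ.+ 2 ℕ.* (1 ℕ.* (r ℕ.* r))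
  expand = ℕ-Solver.solve-∀

codeSize-bound : ∀ s k r n → 1 ≤ r → r ≤ k → n ℕ.* (2 ℕ.* r) ≤ k →
  let T = 2 ℕ.* suc (6 ℕ.* (k ℕ.* (n ℕ.* n))) in
  s ℕ.* (s ℕ.* s) ℕ.* (T ℕ.* (T ℕ.* T)) ℕ.* r ℕ.^ 6 ≤ 125 ℕ.* (s ℕ.^ 3 ℕ.* k ℕ.^ 9)
codeSize-bound s k r n 1≤r r≤k n2r≤k = begin
  s ℕ.* (s ℕ.* s) ℕ.* (T ℕ.* (T ℕ.* T)) ℕ.* r ℕ.^ 6
    ≡⟨ regroup s T r ⟩
  s ℕ.* (s ℕ.* s) ℕ.* (T ℕ.* (r ℕ.* r) ℕ.* (T ℕ.* (r ℕ.* r) ℕ.* (T ℕ.* (r ℕ.* r))))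
    ≤⟨ ℕP.*-monoʳ-≤ (s ℕ.* (s ℕ.* s)) (ℕP.*-mono-≤ Tr²≤ (ℕP.*-mono-≤ Tr²≤ Tr²≤)) ⟩
  s ℕ.* (s ℕ.* s) ℕ.* (5 ℕ.* (k ℕ.* (k ℕ.* k)) ℕ.* (5 ℕ.* (k ℕ.* (k ℕ.* k)) ℕ.* (5 ℕ.* (k ℕ.* (k ℕ.* k)))))
    ≡⟨ collect s k ⟩
  125 ℕ.* (s ℕ.^ 3 ℕ.* k ℕ.^ 9) ∎
  where
  open ℕP.≤-Reasoning
  T = 2 ℕ.* suc (6 ℕ.* (k ℕ.* (n ℕ.* n)))
  Tr²≤ = heightRange*r²≤5k³ k r n 1≤r r≤k n2r≤k
  regroup : ∀ s T r → s ℕ.* (s ℕ.* s) ℕ.* (T ℕ.* (T ℕ.* T)) ℕ.* (r ℕ.* (r ℕ.* (r ℕ.* (r ℕ.* (r ℕ.* (r ℕ.* 1))))))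
    ≡ s ℕ.* (s ℕ.* s) ℕ.* (T ℕ.* (r ℕ.* r) ℕ.* (T ℕ.* (r ℕ.* r) ℕ.* (T ℕ.* (r ℕ.* r))))
  regroup = ℕ-Solver.solve-∀
  collect : ∀ s k → s ℕ.* (s ℕ.* s) ℕ.* (5 ℕ.* (k ℕ.* (k ℕ.* k)) ℕ.* (5 ℕ.* (k ℕ.* (k ℕ.* k)) ℕ.* (5 ℕ.* (k ℕ.* (k ℕ.* k)))))
    ≡ 125 ℕ.* (s ℕ.* (s ℕ.* (s ℕ.* 1)) ℕ.* (k ℕ.* (k ℕ.* (k ℕ.* (k ℕ.* (k ℕ.* (k ℕ.* (k ℕ.* (k ℕ.* (k ℕ.* 1))))))))))
  collect = ℕ-Solver.solve-∀

triangle-count-bound : ∀ {ε k r S Ts} → 0ℚ ℚ.< ε → 1 ≤ r → r ℕ.< k → All (VecOK ε k r) S →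
  (∀ {u v w} → u ∈ S → v ∈ S → w ∈ S → u ≢ v → v ≢ w → u ≢ w → LinIndep u v w) →
  All (IsTriangle S k r) Ts → AllPairs (λ t t′ → ¬ SameTriangle t t′) Ts →
  length Ts ℕ.* r ℕ.^ 6 ≤ 125 ℕ.* (length S ℕ.^ 3 ℕ.* k ℕ.^ 9)
triangle-count-bound {ε} {k} {suc r} {S} 0<ε 1≤r r<k ok indep triangles distinct = ℕP.≤-trans
  (ℕP.*-monoˡ-≤ (suc r ℕ.^ 6) (Triangles.triangle-count k n r (All.map (VecOK⇒Bounded {ε} {k} {r} 0<ε) ok) indep triangles distinct))
  (codeSize-bound (length S) k (suc r) n 1≤r (ℕP.<⇒≤ r<k) (ℕD.m/n*n≤m k (2 ℕ.* suc r)))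
  where
  n = k ℕ./ (2 ℕ.* suc r)

ℕ-*-≤⇒ℚ-*-≤ : ∀ a b c d → a ℕ.* b ≤ c ℕ.* d → (+ a / 1) ℚ.* (+ b / 1) ℚ.≤ (+ c / 1) ℚ.* (+ d / 1)
ℕ-*-≤⇒ℚ-*-≤ a b c d ab≤cd = subst₂ ℚ._≤_ (ι-pos-* a b) (ι-pos-* c d) (ι-mono-≤ (ℤ.+≤+ ab≤cd))
  where
  ι-pos-* : ∀ a b → ι (+ (a ℕ.* b)) ≡ ι (+ a) ℚ.* ι (+ b)
  ι-pos-* a b = trans (cong ι (ℤP.pos-* a b)) (ι-homo-* (+ a) (+ b))

lemma2p4 : (ε : ℚ) → 0ℚ ℚ.< ε → ε ℚ.< 1ℚ →
    Σ ℚ λ c → 0ℚ ℚ.< c × Σ ℕ λ K₀ →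
      ∀ (k r : ℕ) → K₀ ℕ.≤ k → 1 ℕ.≤ r → r ℕ.< k →
      ∀ (S : List Z3) → Unique S →
      All Indivisible S → All (VecOK ε k r) S →
      (∀ {u v w} → u ∈ S → v ∈ S → w ∈ S → u ≢ v → v ≢ w → u ≢ w → LinIndep u v w) →
      TriangleCountBound S k r (λ n →
        ((+ n / 1) ℚ.* (+ (r ℕ.^ 6) / 1)) ℚ.≤ (c ℚ.* (+ (length S ℕ.^ 3 ℕ.* k ℕ.^ 9) / 1)))
lemma2p4 ε 0<ε _ = + 125 / 1 , ℚ.*<* (ℤ.+<+ (s≤s z≤n)) , 0 ,
  λ k r _ 1≤r r<k S _ _ ok indep Ts triangles distinct →
    ℕ-*-≤⇒ℚ-*-≤ (length Ts) (r ℕ.^ 6) 125 (length S ℕ.^ 3 ℕ.* k ℕ.^ 9)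
      (triangle-count-bound 0<ε 1≤r r<k ok indep triangles distinct)
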